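{- Let $n$ be a nonzero integer, $a,b$ odd positive integers, and $p\equiv3\pmod4$ a prime with $p\nmid an$. Then $1/2\notin I_p$.
   Context: $\mathfrak X=\operatorname{Spec}\mathbb{Z}[X,Y,Z]/(X^2+Y^2+Z^{ab}-n^a)$; $\mathfrak X(\mathbb{Z}_p)$ is the set of solutions in $\mathbb{Z}_p^3$. For $u\in\mathbb{Q}_p^\times$, $(u,-1)_p=1$ if $u$ is a sum of two squares in $\mathbb{Q}_p$, else $-1$. Let $g(Z)=\sum_{i=0}^{a-1}n^{a-1-i}Z^{ib}$. $A$ is the Azumaya algebra on $\mathfrak X_\mathbb{Q}$ given by the quaternion algebra $(n-Z^b,-1)$ on $D(n-Z^b)$ and $(g(Z),-1)$ on $D(g(Z))$, glued via $i\mapsto(Xi'+Yi'j')/g(Z)$, $j\mapsto j'$; for $P=(x,y,z)\in\mathfrak X(\mathbb{Q}_p)$, $\operatorname{inv}_pA(P)\in\{0,1/2\}$ is $0$ iff $(n-z^b,-1)_p=1$ when $n\neq z^b$, and $0$ iff $(g(z),-1)_p=1$ when $g(z)\neq0$. $I_p=\{\operatorname{inv}_pA(P)\mid P\in\mathfrak X(\mathbb{Z}_p)\}$. -}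

module Defs where

open import Data.Nat as ℕ using (ℕ; zero; suc)
open import Data.Integer using (ℤ; +_; _+_; _-_; _*_; _^_)
open import Data.Integer.Divisibility using (_∣_)
open import Data.Product using (Σ; Σ-syntax; ∃; ∃-syntax; _×_)
open import Data.Sum using (_⊎_)
open import Relation.Nullary using (¬_)

_≡_[mod_] : ℤ → ℤ → ℕ → Set
a ≡ b [mod m ] = (+ m) ∣ (a - b)

-- p-adic integers as the inverse limit  ℤₚ = lim ℤ/p^k ℤ.
-- A "residue sequence" is x : ℕ → ℤ, x k standing for an element of
-- ℤ/p^k.  Two sequences denote the
-- same p-adic number iff they agree modulo p^k for every k.

Seq : Set
Seq = ℕ → ℤ

_≈⟨_⟩_ : Seq → ℕ → Seq → Set
x ≈⟨ p ⟩ y = ∀ k → x k ≡ y k [mod (p ℕ.^ k) ]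

Coherent : ℕ → Seq → Set
Coherent p x = ∀ k → x (suc k) ≡ x k [mod (p ℕ.^ k) ]

record ℤₚ (p : ℕ) : Set where
  constructor mkℤₚ
  field
    res : Seq
    coh : Coherent p res
open ℤₚ public

cst : ℤ → Seq
cst c k = c

_⊕_ : Seq → Seq → Seq
(x ⊕ y) k = x k + y k

_⊖_ : Seq → Seq → Seq
(x ⊖ y) k = x k - y k

_⊗_ : Seq → Seq → Seq
(x ⊗ y) k = x k * y k

_⊙^_ : Seq → ℕ → Seq
(x ⊙^ e) k = x k ^ e

infixl 6 _⊕_ _⊖_
infixl 7 _⊗_
infixr 8 _⊙^_

sumSeq : ℕ → (ℕ → Seq) → Seq
sumSeq zero    f = cst (+ 0)
sumSeq (suc m) f = sumSeq m f ⊕ f m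

OnX : (p : ℕ) (n : ℤ) (a b : ℕ) → ℤₚ p → ℤₚ p → ℤₚ p → Set
OnX p n a b x y z =
  (res x ⊙^ 2 ⊕ res y ⊙^ 2 ⊕ res z ⊙^ (a ℕ.* b)) ≈⟨ p ⟩ (cst n ⊙^ a)

gSeq : (n : ℤ) (a b : ℕ) → Seq → Seq
gSeq n a b z = sumSeq a (λ i → cst (n ^ (a ℕ.∸ 1 ℕ.∸ i)) ⊗ z ⊙^ (i ℕ.* b))

-- Hilbert symbol (u,-1)_p = 1 for u ∈ ℤₚ ⊂ ℚₚ:
-- u is a sum of two squares in ℚₚ.  Every element of ℚₚ is s / p^m with
-- s ∈ ℤₚ, so this says: p^{2m} u = s² + t² for some m and s, t ∈ ℤₚ.

SumTwoSqQₚ : (p : ℕ) → Seq → Set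
SumTwoSqQₚ p u =
  Σ[ m ∈ ℕ ] Σ[ s ∈ ℤₚ p ] Σ[ t ∈ ℤₚ p ]
    (cst (+ (p ℕ.^ (2 ℕ.* m))) ⊗ u) ≈⟨ p ⟩ (res s ⊙^ 2 ⊕ res t ⊙^ 2)

NonZeroₚ : ℕ → Seq → Set
NonZeroₚ p u = ¬ (u ≈⟨ p ⟩ cst (+ 0))

-- inv_p A(P) = 1/2 at P = (x,y,z):  using the chart D(n - Z^b) when
-- n ≠ z^b and the chart D(g(Z)) when g(z) ≠ 0 (the two agree on overlaps).

InvHalf : (p : ℕ) (n : ℤ) (a b : ℕ) → ℤₚ p → Set
InvHalf p n a b z =
  (NonZeroₚ p (cst n ⊖ res z ⊙^ b) × ¬ SumTwoSqQₚ p (cst n ⊖ res z ⊙^ b))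
  ⊎ (NonZeroₚ p (gSeq n a b (res z)) × ¬ SumTwoSqQₚ p (gSeq n a b (res z)))

HalfInIₚ : (p : ℕ) (n : ℤ) (a b : ℕ) → Set
HalfInIₚ p n a b =
  Σ[ x ∈ ℤₚ p ] Σ[ y ∈ ℤₚ p ] Σ[ z ∈ ℤₚ p ] (OnX p n a b x y z × InvHalf p n a b z)

-- Put u = n - z^b and w = g(z).  Telescoping gives u·w = n^a - z^{ab}, which
-- equals x² + y² on 𝔛.  Modulo a prime dividing u every summand of g is
-- n^{a-1}, so n·w ≡ a·n^a; hence p ∤ a n cannot divide both u and w.  Over
-- ℤₚ with p odd every unit is a sum of two squares: pigeonhole gives
-- u ≡ s² + t² (mod p) with p ∤ s, and Hensel's lemma lifts s.  So u is a sum
-- of two squares when p ∤ u, and when p ∣ u the unit w is invertible and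
-- u = (x² + y²)·w⁻¹ is a product of sums of two squares.  By symmetry the
-- same holds for w, so (u,-1)_p = (w,-1)_p = 1 and inv_p A(P) = 0.

module Submission where

open import Defs hiding (_≈⟨_⟩_)

open import Data.Nat as ℕ using (ℕ; _%_)
import Data.Nat.Properties as ℕ
import Data.Nat.Divisibility as ℕ
import Data.Nat.DivMod as ℕ
open import Data.Nat.Primality
  using (Prime; euclidsLemma; prime⇒nonZero; prime⇒nonTrivial; prime⇒irreducible; prime[2])
open import Data.Nat.Coprimality using (Coprime; coprime-Bézout)
open import Data.Nat.GCD using (module Bézout)
open import Data.Nat.Tactic.RingSolver using () renaming (solve-∀ to ℕ-solve-∀)
open import Data.Integer using (ℤ; +_; -[1+_]; _+_; _-_; -_; _*_; _^_; ∣_∣; 0ℤ; 1ℤ)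
import Data.Integer.Properties as ℤ
open import Data.Integer.DivMod as ℤ using (_%ℕ_; _/ℕ_)
open import Data.Integer.Divisibility using (_∣_)
import Data.Integer.Divisibility.Signed as Signed
open import Data.Integer.Tactic.RingSolver using (solve-∀)
open import Data.Fin using (Fin; toℕ; fromℕ<; splitAt; join)
import Data.Fin.Properties as Fin
open import Data.Fin.Properties using (toℕ-fromℕ<; toℕ-injective; toℕ<n; pigeonhole; join-splitAt)
open import Data.Product using (Σ; ∃₂; _×_; _,_; proj₁; proj₂; swap)
open import Data.Sum using (_⊎_; inj₁; inj₂; [_,_])
open import Data.Empty using (⊥-elim)
open import Function using (_∘_; case_of_)
open import Function.Definitions using (Injective)
open import Level using (0ℓ)
open import Relation.Nullary using (¬_; Dec; yes; no)
open import Relation.Binary.Bundles using (Setoid)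
import Relation.Binary.Reasoning.Setoid
open import Relation.Binary.PropositionalEquality
  using (_≡_; _≢_; refl; sym; trans; cong; cong₂; subst; module ≡-Reasoning)

-- Congruence modulo m, packaged as a record so that x and y can be
-- inferred from its type (the unsigned divisibility in Defs cannot).
infix 4 _≋_[mod_]
record _≋_[mod_] (x y : ℤ) (m : ℕ) : Set where
  constructor byDivisibility
  field divides : + m Signed.∣ x - y
open _≋_[mod_]

≋⇒≡mod : ∀ {x y m} → x ≋ y [mod m ] → x ≡ y [mod m ]
≋⇒≡mod x≋y = Signed.∣⇒∣ᵤ (divides x≋y)

≡mod⇒≋ : ∀ {x y m} → x ≡ y [mod m ] → x ≋ y [mod m ]
≡mod⇒≋ x≡y = byDivisibility (Signed.∣ᵤ⇒∣ x≡y)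

module _ {m : ℕ} where

  -- Congruences are proved by rewriting x - y, by a ring identity, into a
  -- combination of quantities already known to be divisible by m.
  byDiff : ∀ {x y} d → x - y ≡ d → + m Signed.∣ d → x ≋ y [mod m ]
  byDiff d x-y≡d m∣d = byDivisibility (subst (Signed._∣_ (+ m)) (sym x-y≡d) m∣d)

  ≡⇒≋ : ∀ {x y} → x ≡ y → x ≋ y [mod m ]
  ≡⇒≋ {x} refl = byDiff 0ℤ (ℤ.+-inverseʳ x) (Signed.∣ᵤ⇒∣ (ℕ._∣0 m))

  ≋-refl : ∀ {x} → x ≋ x [mod m ]
  ≋-refl = ≡⇒≋ refl

  ≋-sym : ∀ {x y} → x ≋ y [mod m ] → y ≋ x [mod m ]
  ≋-sym {x} {y} x≋y = byDiff (- (x - y)) (identity x y) (Signed.∣m⇒∣-m (divides x≋y))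
    where identity : ∀ x y → y - x ≡ - (x - y)
          identity = solve-∀

  ≋-trans : ∀ {x y z} → x ≋ y [mod m ] → y ≋ z [mod m ] → x ≋ z [mod m ]
  ≋-trans {x} {y} {z} x≋y y≋z =
    byDiff ((x - y) + (y - z)) (identity x y z) (Signed.∣m∣n⇒∣m+n (divides x≋y) (divides y≋z))
    where identity : ∀ x y z → x - z ≡ (x - y) + (y - z)
          identity = solve-∀

  +-cong : ∀ {x x' y y'} → x ≋ x' [mod m ] → y ≋ y' [mod m ] → x + y ≋ x' + y' [mod m ]
  +-cong {x} {x'} {y} {y'} x≋x' y≋y' =
    byDiff ((x - x') + (y - y')) (identity x x' y y') (Signed.∣m∣n⇒∣m+n (divides x≋x') (divides y≋y'))
    where identity : ∀ x x' y y' → (x + y) - (x' + y') ≡ (x - x') + (y - y')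
          identity = solve-∀

  -‿cong : ∀ {x x'} → x ≋ x' [mod m ] → - x ≋ - x' [mod m ]
  -‿cong {x} {x'} x≋x' = byDiff (- (x - x')) (identity x x') (Signed.∣m⇒∣-m (divides x≋x'))
    where identity : ∀ x x' → - x - - x' ≡ - (x - x')
          identity = solve-∀

  -cong : ∀ {x x' y y'} → x ≋ x' [mod m ] → y ≋ y' [mod m ] → x - y ≋ x' - y' [mod m ]
  -cong x≋x' y≋y' = +-cong x≋x' (-‿cong y≋y')

  *-cong : ∀ {x x' y y'} → x ≋ x' [mod m ] → y ≋ y' [mod m ] → x * y ≋ x' * y' [mod m ]
  *-cong {x} {x'} {y} {y'} x≋x' y≋y' =
    byDiff (x * (y - y') + (x - x') * y') (identity x x' y y')
      (Signed.∣m∣n⇒∣m+n (Signed.∣n⇒∣m*n x (divides y≋y')) (Signed.∣m⇒∣m*n y' (divides x≋x')))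
    where identity : ∀ x x' y y' → x * y - x' * y' ≡ x * (y - y') + (x - x') * y'
          identity = solve-∀

  *-congˡ : ∀ c {x x'} → x ≋ x' [mod m ] → c * x ≋ c * x' [mod m ]
  *-congˡ c = *-cong (≋-refl {c})

  *-congʳ : ∀ c {x x'} → x ≋ x' [mod m ] → x * c ≋ x' * c [mod m ]
  *-congʳ c x≋x' = *-cong x≋x' (≋-refl {c})

  ^-cong : ∀ {x x'} e → x ≋ x' [mod m ] → x ^ e ≋ x' ^ e [mod m ]
  ^-cong ℕ.zero    x≋x' = ≋-refl
  ^-cong (ℕ.suc e) x≋x' = *-cong x≋x' (^-cong e x≋x')

≋-setoid : ℕ → Setoid 0ℓ 0ℓ
≋-setoid m = record
  { Carrier = ℤ
  ; _≈_ = λ x y → x ≋ y [mod m ]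
  ; isEquivalence = record { refl = ≋-refl ; sym = ≋-sym ; trans = ≋-trans }
  }

module ≋-Reasoning (m : ℕ) = Relation.Binary.Reasoning.Setoid (≋-setoid m)

-cancelˡ : ∀ {m u x y} → u - x ≋ u - y [mod m ] → x ≋ y [mod m ]
-cancelˡ {m} {u} {x} {y} u-x≋u-y = byDiff (- ((u - x) - (u - y))) (identity u x y) (Signed.∣m⇒∣-m (divides u-x≋u-y))
  where identity : ∀ u x y → x - y ≡ - ((u - x) - (u - y))
        identity = solve-∀

-move : ∀ {m x y z} → x + y ≋ z [mod m ] → x ≋ z - y [mod m ]
-move {m} {x} {y} {z} x+y≋z = byDiff ((x + y) - z) (identity x y z) (divides x+y≋z)
  where identity : ∀ x y z → x - (z - y) ≡ (x + y) - z
        identity = solve-∀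

+-move : ∀ {m x y z} → x ≋ z - y [mod m ] → x + y ≋ z [mod m ]
+-move {m} {x} {y} {z} x≋z-y = byDiff (x - (z - y)) (identity x y z) (divides x≋z-y)
  where identity : ∀ x y z → (x + y) - z ≡ x - (z - y)
        identity = solve-∀

≋⇒diff≋0 : ∀ {m x y} → x ≋ y [mod m ] → x - y ≋ 0ℤ [mod m ]
≋⇒diff≋0 {m} {x} {y} x≋y = byDiff (x - y) (ℤ.+-identityʳ (x - y)) (divides x≋y)

diff≋0⇒≋ : ∀ {m x y} → x - y ≋ 0ℤ [mod m ] → x ≋ y [mod m ]
diff≋0⇒≋ {m} {x} {y} x-y≋0 = byDivisibility (subst (Signed._∣_ (+ m)) (ℤ.+-identityʳ (x - y)) (divides x-y≋0))

difference-of-squares : ∀ {m x y} → x * x ≋ y * y [mod m ] → (x - y) * (x + y) ≋ 0ℤ [mod m ]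
difference-of-squares {m} {x} {y} x²≋y² = byDiff (x * x - y * y) (identity x y) (divides x²≋y²)
  where identity : ∀ x y → (x - y) * (x + y) - 0ℤ ≡ x * x - y * y
        identity = solve-∀

≋0⇒∣ : ∀ {m x} → x ≋ 0ℤ [mod m ] → + m ∣ x
≋0⇒∣ {m} {x} x≋0 = Signed.∣⇒∣ᵤ (subst (Signed._∣_ (+ m)) (ℤ.+-identityʳ x) (divides x≋0))

∣⇒≋0 : ∀ {m x} → + m ∣ x → x ≋ 0ℤ [mod m ]
∣⇒≋0 {m} {x} m∣x = byDiff x (ℤ.+-identityʳ x) (Signed.∣ᵤ⇒∣ m∣x)

*-zeroˡ : ∀ {m} c {x} → x ≋ 0ℤ [mod m ] → c * x ≋ 0ℤ [mod m ]
*-zeroˡ c x≋0 = ≋-trans (*-congˡ c x≋0) (≡⇒≋ (ℤ.*-zeroʳ c))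

*-zero : ∀ {m d x y} → x ≋ 0ℤ [mod m ] → y ≋ 0ℤ [mod d ] → x * y ≋ 0ℤ [mod m ℕ.* d ]
*-zero {m} {d} {x} {y} x≋0 y≋0 =
  ∣⇒≋0 (subst (m ℕ.* d ℕ.∣_) (sym (ℤ.abs-* x y)) (ℕ.*-pres-∣ (≋0⇒∣ x≋0) (≋0⇒∣ y≋0)))

≋-weaken : ∀ {d m x y} → d ℕ.∣ m → x ≋ y [mod m ] → x ≋ y [mod d ]
≋-weaken d∣m x≋y = byDivisibility (Signed.∣-trans (Signed.∣ᵤ⇒∣ d∣m) (divides x≋y))

≋-mod-1 : ∀ {x y} → x ≋ y [mod 1 ]
≋-mod-1 {x} {y} = byDiff (x - y) refl (Signed.∣ᵤ⇒∣ (ℕ.1∣ ∣ x - y ∣))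

∣-*ʳ : ∀ {d} x y → + d ∣ x → + d ∣ x * y
∣-*ʳ {d} x y d∣x = Signed.∣⇒∣ᵤ {+ d} {x * y} (Signed.∣m⇒∣m*n y (Signed.∣ᵤ⇒∣ {+ d} {x} d∣x))

∣-*ˡ : ∀ {d} x y → + d ∣ y → + d ∣ x * y
∣-*ˡ {d} x y d∣y = Signed.∣⇒∣ᵤ {+ d} {x * y} (Signed.∣n⇒∣m*n x (Signed.∣ᵤ⇒∣ {+ d} {y} d∣y))

^2≡* : ∀ x → x ^ 2 ≡ x * x
^2≡* x = cong (x *_) (ℤ.*-identityʳ x)

images-meet : ∀ {h m} → m ℕ.< h ℕ.+ h → (f g : Fin h → Fin m) →
              Injective _≡_ _≡_ f → Injective _≡_ _≡_ g → ∃₂ λ a b → f a ≡ g b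
images-meet {h} {m} m<2h f g f-inj g-inj with pigeonhole m<2h ([ f , g ] ∘ splitAt h)
... | i , j , i<j , fi≡fj = meet (splitAt h i) (splitAt h j) distinct fi≡fj
  where
  distinct : splitAt h i ≢ splitAt h j
  distinct eq = Fin.<-irrefl (trans (sym (join-splitAt h h i))
                               (trans (cong (join h h) eq) (join-splitAt h h j))) i<j
  meet : ∀ x y → x ≢ y → [ f , g ] x ≡ [ f , g ] y → ∃₂ λ a b → f a ≡ g b
  meet (inj₁ a) (inj₁ b) a≢b fa≡fb = ⊥-elim (a≢b (cong inj₁ (f-inj fa≡fb)))
  meet (inj₂ a) (inj₂ b) a≢b ga≡gb = ⊥-elim (a≢b (cong inj₂ (g-inj ga≡gb)))
  meet (inj₁ a) (inj₂ b) _   fa≡gb = a , b , fa≡gb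
  meet (inj₂ a) (inj₁ b) _   ga≡fb = b , a , sym ga≡fb

module PrimeModulus {p : ℕ} (p-prime : Prime p) where

  instance
    p-nonZero : ℕ.NonZero p
    p-nonZero = prime⇒nonZero p-prime

  euclid : ∀ x y → + p ∣ x * y → (+ p ∣ x) ⊎ (+ p ∣ y)
  euclid x y p∣xy = euclidsLemma ∣ x ∣ ∣ y ∣ p-prime (subst (p ℕ.∣_) (ℤ.abs-* x y) p∣xy)

  p∤1 : ¬ (+ p ∣ 1ℤ)
  p∤1 p∣1 = ℕ.nonTrivial⇒≢1 {{prime⇒nonTrivial p-prime}} (ℕ.∣1⇒≡1 p∣1)

  ∤-^ : ∀ {x} e → ¬ (+ p ∣ x) → ¬ (+ p ∣ x ^ e)
  ∤-^ ℕ.zero    p∤x = p∤1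
  ∤-^ {x} (ℕ.suc e) p∤x p∣xᵉ⁺¹ = [ p∤x , ∤-^ e p∤x ] (euclid x (x ^ e) p∣xᵉ⁺¹)

  coprime : ∀ {k} → ¬ (p ℕ.∣ k) → Coprime p k
  coprime p∤k (d∣p , d∣k) with prime⇒irreducible p-prime d∣p
  ... | inj₁ d≡1 = d≡1
  ... | inj₂ refl = ⊥-elim (p∤k d∣k)

  ℕ-inverse : ∀ k → ¬ (p ℕ.∣ k) → Σ ℤ λ e → + k * e ≋ 1ℤ [mod p ]
  ℕ-inverse k p∤k with coprime-Bézout (coprime p∤k)
  ... | Bézout.+- x y 1+yk≡xp = - + y , (begin
      + k * - + y              ≡⟨ unfold k y ⟩
      1ℤ - + (1 ℕ.+ y ℕ.* k)  ≈⟨ -cong (≋-refl {x = 1ℤ}) (∣⇒≋0 {x = + (1 ℕ.+ y ℕ.* k)}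
                                                                (ℕ.divides x 1+yk≡xp)) ⟩
      1ℤ - 0ℤ                  ≡⟨⟩
      1ℤ                       ∎)
    where
    open ≋-Reasoning p
    unfold : ∀ k y → + k * - + y ≡ 1ℤ - + (1 ℕ.+ y ℕ.* k)
    unfold k y = trans (identity (+ k) (+ y)) (cong (λ z → 1ℤ - (1ℤ + z)) (sym (ℤ.pos-* y k)))
      where identity : ∀ k y → k * - y ≡ 1ℤ - (1ℤ + y * k)
            identity = solve-∀
  ... | Bézout.-+ x y 1+xp≡yk = + y , (begin
      + k * + y               ≡⟨ unfold k y ⟩
      + (y ℕ.* k)             ≡⟨ cong +_ (sym 1+xp≡yk) ⟩
      1ℤ + + (x ℕ.* p)        ≈⟨ +-cong (≋-refl {x = 1ℤ}) (∣⇒≋0 {x = + (x ℕ.* p)} (ℕ.n∣m*n x)) ⟩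
      1ℤ + 0ℤ                 ≡⟨⟩
      1ℤ                      ∎)
    where
    open ≋-Reasoning p
    unfold : ∀ k y → + k * + y ≡ + (y ℕ.* k)
    unfold k y = trans (ℤ.*-comm (+ k) (+ y)) (sym (ℤ.pos-* y k))

  inverse : ∀ c → ¬ (+ p ∣ c) → Σ ℤ λ e → c * e ≋ 1ℤ [mod p ]
  inverse (+ k)      p∤c = ℕ-inverse k p∤c
  inverse -[1+ k ]   p∤c with ℕ-inverse (ℕ.suc k) p∤c
  ... | e , ke≋1 = - e , ≋-trans (≡⇒≋ (identity (+ ℕ.suc k) e)) ke≋1
    where identity : ∀ k e → - k * - e ≡ k * e
          identity = solve-∀

  small-multiple : ∀ {n} → p ℕ.∣ n → n ℕ.< p → n ≡ 0
  small-multiple {ℕ.zero}  _   _   = refl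
  small-multiple {ℕ.suc n} p∣n n<p = ⊥-elim (ℕ.>⇒∤ n<p p∣n)

  residue : ℤ → Fin p
  residue x = fromℕ< (ℤ.n%ℕd<d x p)

  residue-≋ : ∀ x y → residue x ≡ residue y → x ≋ y [mod p ]
  residue-≋ x y same = byDiff ((qx - qy) * + p) x-y≡[qx-qy]p (Signed.∣n⇒∣m*n (qx - qy) Signed.∣-refl)
    where
    rx ry qx qy : ℤ
    rx = + (x %ℕ p)
    ry = + (y %ℕ p)
    qx = x /ℕ p
    qy = y /ℕ p
    same-remainder : x %ℕ p ≡ y %ℕ p
    same-remainder = trans (sym (toℕ-fromℕ< (ℤ.n%ℕd<d x p)))
                           (trans (cong toℕ same) (toℕ-fromℕ< (ℤ.n%ℕd<d y p)))
    identity : ∀ r qx qy P → (r + qx * P) - (r + qy * P) ≡ (qx - qy) * P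
    identity = solve-∀
    open ≡-Reasoning
    x-y≡[qx-qy]p : x - y ≡ (qx - qy) * + p
    x-y≡[qx-qy]p = begin
      x - y                              ≡⟨ cong₂ _-_ (ℤ.a≡a%ℕn+[a/ℕn]*n x p) (ℤ.a≡a%ℕn+[a/ℕn]*n y p) ⟩
      (rx + qx * + p) - (ry + qy * + p)  ≡⟨ cong (λ r → (rx + qx * + p) - (+ r + qy * + p)) (sym same-remainder) ⟩
      (rx + qx * + p) - (rx + qy * + p)  ≡⟨ identity rx qx qy (+ p) ⟩
      (qx - qy) * + p                    ∎

module OddPrime {p : ℕ} (p-prime : Prime p) (odd : p % 2 ≡ 1) where
  open PrimeModulus p-prime

  h : ℕ
  h = p ℕ./ 2

  p≡1+2h : p ≡ 1 ℕ.+ h ℕ.+ h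
  p≡1+2h = trans (ℕ.m≡m%n+[m/n]*n p 2) (trans (cong (ℕ._+ h ℕ.* 2) odd) (double h))
    where double : ∀ h → 1 ℕ.+ h ℕ.* 2 ≡ 1 ℕ.+ h ℕ.+ h
          double = ℕ-solve-∀

  -- 2 is a unit modulo p, which is what oddness is used for in Hensel's lemma.
  p∤2 : ¬ (+ p ∣ + 2)
  p∤2 p∣2 with prime⇒irreducible prime[2] p∣2
  ... | inj₁ p≡1  = ℕ.nonTrivial⇒≢1 {{prime⇒nonTrivial p-prime}} p≡1
  ... | inj₂ refl = case odd of λ ()

  sum<p : ∀ {a b} → a ℕ.≤ h → b ℕ.≤ h → a ℕ.+ b ℕ.< p
  sum<p a≤h b≤h = subst (_ ℕ.<_) (sym p≡1+2h) (ℕ.s≤s (ℕ.+-mono-≤ a≤h b≤h))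

  -- The squares of 0, 1, …, h are pairwise incongruent modulo p, since
  -- p cannot divide a - b or a + b unless a = b.
  squares-distinct : ∀ {a b} → a ℕ.≤ h → b ℕ.≤ h → + a * + a ≋ + b * + b [mod p ] → a ≡ b
  squares-distinct {a} {b} a≤h b≤h a²≋b²
    with euclid (+ a - + b) (+ a + + b) (≋0⇒∣ (difference-of-squares {x = + a} {y = + b} a²≋b²))
  ... | inj₁ p∣a-b = ℤ.+-injective (ℤ.i-j≡0⇒i≡j (+ a) (+ b) (ℤ.∣i∣≡0⇒i≡0 (small-multiple p∣a-b ∣a-b∣<p)))
    where
    ∣a-b∣<p : ∣ + a - + b ∣ ℕ.< p
    ∣a-b∣<p = ℕ.≤-<-trans (ℕ.≤-trans (ℤ.∣i+j∣≤∣i∣+∣j∣ (+ a) (- + b))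
                                      (ℕ.≤-reflexive (cong (a ℕ.+_) (ℤ.∣-i∣≡∣i∣ (+ b)))))
                          (sum<p a≤h b≤h)
  ... | inj₂ p∣a+b = trans (ℕ.m+n≡0⇒m≡0 a a+b≡0) (sym (ℕ.m+n≡0⇒n≡0 a a+b≡0))
    where
    a+b≡0 : a ℕ.+ b ≡ 0
    a+b≡0 = small-multiple p∣a+b (sum<p a≤h b≤h)

  -- Every residue u modulo p is a sum of two squares: the h + 1 residues
  -- of s² and the h + 1 residues of u - t² cannot all be distinct.
  sum-of-two-squares : ∀ u → ∃₂ λ s t → s * s + t * t ≋ u [mod p ]
  sum-of-two-squares u =
    from-collision (images-meet 2h+1<2h+2 (residue ∘ square) (residue ∘ complement)
                                (λ {a} {b} same → square-inj (residue-≋ (square a) (square b) same))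
                                (λ {a} {b} same → square-inj (-cancelˡ {u = u} (residue-≋ (complement a) (complement b) same))))
    where
    square complement : Fin (ℕ.suc h) → ℤ
    square a = + toℕ a * + toℕ a
    complement a = u - square a
    2h+1<2h+2 : p ℕ.< ℕ.suc h ℕ.+ ℕ.suc h
    2h+1<2h+2 = subst (λ q → q ℕ.< ℕ.suc h ℕ.+ ℕ.suc h) (sym p≡1+2h) (ℕ.s≤s (ℕ.≤-reflexive (sym (ℕ.+-suc h h))))
    square-inj : ∀ {a b} → square a ≋ square b [mod p ] → a ≡ b
    square-inj {a} {b} a²≋b² =
      toℕ-injective (squares-distinct (ℕ.s≤s⁻¹ (toℕ<n a)) (ℕ.s≤s⁻¹ (toℕ<n b)) a²≋b²)
    from-collision : (∃₂ λ a b → residue (square a) ≡ residue (complement b)) → ∃₂ λ s t → s * s + t * t ≋ u [mod p ]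
    from-collision (a , b , same) = + toℕ a , + toℕ b , +-move (residue-≋ (square a) (complement b) same)

  sum-of-two-squares-unit : ∀ u → ¬ (+ p ∣ u) → ∃₂ λ s t → (s * s + t * t ≋ u [mod p ]) × ¬ (+ p ∣ s)
  sum-of-two-squares-unit u p∤u = pick (sum-of-two-squares u)
    where
    choose : ∀ s t → s * s + t * t ≋ u [mod p ] → Dec (+ p ∣ s) → Dec (+ p ∣ t) →
             ∃₂ λ s t → (s * s + t * t ≋ u [mod p ]) × ¬ (+ p ∣ s)
    choose s t s²+t²≋u (no p∤s)  _          = s , t , s²+t²≋u , p∤s
    choose s t s²+t²≋u (yes _)   (no p∤t)   = t , s , ≋-trans (≡⇒≋ (ℤ.+-comm (t * t) (s * s))) s²+t²≋u , p∤t
    choose s t s²+t²≋u (yes p∣s) (yes p∣t)  = ⊥-elim (p∤u (≋0⇒∣ (≋-trans (≋-sym s²+t²≋u)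
                                                (+-cong (*-cong s≋0 s≋0) (*-cong t≋0 t≋0)))))
      where
      s≋0 : s ≋ 0ℤ [mod p ]
      s≋0 = ∣⇒≋0 p∣s
      t≋0 : t ≋ 0ℤ [mod p ]
      t≋0 = ∣⇒≋0 p∣t
    pick : (∃₂ λ s t → s * s + t * t ≋ u [mod p ]) → ∃₂ λ s t → (s * s + t * t ≋ u [mod p ]) × ¬ (+ p ∣ s)
    pick (s , t , s²+t²≋u) = choose s t s²+t²≋u (p ℕ.∣? ∣ s ∣) (p ℕ.∣? ∣ t ∣)

module ResidueSequences (p : ℕ) where

  infix 4 _≃_
  _≃_ : Seq → Seq → Set
  x ≃ y = ∀ k → x k ≋ y k [mod p ℕ.^ k ]

  ≃⇒≈ : ∀ {x y} → x ≃ y → x Defs.≈⟨ p ⟩ y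
  ≃⇒≈ x≃y k = ≋⇒≡mod (x≃y k)

  ≃-trans : ∀ {x y z} → x ≃ y → y ≃ z → x ≃ z
  ≃-trans x≃y y≃z k = ≋-trans (x≃y k) (y≃z k)

  IsCoherent : Seq → Set
  IsCoherent x = ∀ k → x (ℕ.suc k) ≋ x k [mod p ℕ.^ k ]

  coherent : (x : ℤₚ p) → IsCoherent (res x)
  coherent x k = ≡mod⇒≋ (coh x k)

  fromCoherent : (x : Seq) → IsCoherent x → ℤₚ p
  fromCoherent x x-coh = mkℤₚ x (λ k → ≋⇒≡mod (x-coh k))

  level₁⇒mod-p : ∀ {x y} → x ≋ y [mod p ℕ.^ 1 ] → x ≋ y [mod p ]
  level₁⇒mod-p = ≋-weaken (ℕ.m∣m*n 1)

  coherent⇒level₁ : ∀ {x} → IsCoherent x → ∀ k → x (ℕ.suc k) ≋ x 1 [mod p ]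
  coherent⇒level₁ x-coh ℕ.zero    = ≋-refl
  coherent⇒level₁ x-coh (ℕ.suc k) =
    ≋-trans (≋-weaken (ℕ.m∣m*n (p ℕ.^ k)) (x-coh (ℕ.suc k))) (coherent⇒level₁ x-coh k)

  cst-coh : ∀ c → IsCoherent (cst c)
  cst-coh c k = ≋-refl

  ⊕-coh : ∀ {x y} → IsCoherent x → IsCoherent y → IsCoherent (x ⊕ y)
  ⊕-coh x-coh y-coh k = +-cong (x-coh k) (y-coh k)

  ⊖-coh : ∀ {x y} → IsCoherent x → IsCoherent y → IsCoherent (x ⊖ y)
  ⊖-coh x-coh y-coh k = -cong (x-coh k) (y-coh k)

  ⊗-coh : ∀ {x y} → IsCoherent x → IsCoherent y → IsCoherent (x ⊗ y)
  ⊗-coh x-coh y-coh k = *-cong (x-coh k) (y-coh k)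

  ⊙^-coh : ∀ {x} e → IsCoherent x → IsCoherent (x ⊙^ e)
  ⊙^-coh e x-coh k = ^-cong e (x-coh k)

  sumSeq-coh : ∀ m {f} → (∀ i → IsCoherent (f i)) → IsCoherent (sumSeq m f)
  sumSeq-coh ℕ.zero    f-coh = cst-coh 0ℤ
  sumSeq-coh (ℕ.suc m) f-coh = ⊕-coh (sumSeq-coh m f-coh) (f-coh m)

  infixl 6 _+ₚ_ _-ₚ_
  infixl 7 _*ₚ_
  _+ₚ_ _-ₚ_ _*ₚ_ : ℤₚ p → ℤₚ p → ℤₚ p
  x +ₚ y = fromCoherent (res x ⊕ res y) (⊕-coh (coherent x) (coherent y))
  x -ₚ y = fromCoherent (res x ⊖ res y) (⊖-coh (coherent x) (coherent y))
  x *ₚ y = fromCoherent (res x ⊗ res y) (⊗-coh (coherent x) (coherent y))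

  constₚ : ℤ → ℤₚ p
  constₚ c = fromCoherent (cst c) (cst-coh c)

  SumOfTwoSquares : Seq → Set
  SumOfTwoSquares u = Σ (ℤₚ p) λ s → Σ (ℤₚ p) λ t → u ≃ res s ⊗ res s ⊕ res t ⊗ res t

  sum-of-two-squares-resp : ∀ {u v} → u ≃ v → SumOfTwoSquares v → SumOfTwoSquares u
  sum-of-two-squares-resp u≃v (s , t , v≃s²+t²) = s , t , ≃-trans u≃v v≃s²+t²

  -- Brahmagupta–Fibonacci: (a² + b²)(c² + d²) = (ac - bd)² + (ad + bc)².
  sum-of-two-squares-* : ∀ {u v} → SumOfTwoSquares u → SumOfTwoSquares v → SumOfTwoSquares (u ⊗ v)
  sum-of-two-squares-* (a , b , u≃) (c , d , v≃) =
    a *ₚ c -ₚ b *ₚ d , a *ₚ d +ₚ b *ₚ c ,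
    λ k → ≋-trans (*-cong (u≃ k) (v≃ k)) (≡⇒≋ (identity (res a k) (res b k) (res c k) (res d k)))
    where
    identity : ∀ a b c d → (a * a + b * b) * (c * c + d * d) ≡
                           (a * c - b * d) * (a * c - b * d) + (a * d + b * c) * (a * d + b * c)
    identity = solve-∀

  toSumTwoSqQₚ : ∀ {u} → SumOfTwoSquares u → SumTwoSqQₚ p u
  toSumTwoSqQₚ {u} (s , t , u≃) = 0 , s , t , ≃⇒≈ λ k →
    ≋-trans (≡⇒≋ (ℤ.*-identityˡ (u k)))
            (≋-trans (u≃ k) (≡⇒≋ (sym (cong₂ _+_ (^2≡* (res s k)) (^2≡* (res t k))))))

quad : ℤ → ℤ → ℤ → ℤ → ℤ
quad α β γ t = α * t * t + β * t + γ

quad′ : ℤ → ℤ → ℤ → ℤ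
quad′ α β t = + 2 * α * t + β

quad-cong : ∀ {m} α {β β′ γ γ′ t t′} → β ≋ β′ [mod m ] → γ ≋ γ′ [mod m ] → t ≋ t′ [mod m ] →
            quad α β γ t ≋ quad α β′ γ′ t′ [mod m ]
quad-cong α β≋ γ≋ t≋ = +-cong (+-cong (*-cong (*-congˡ α t≋) t≋) (*-cong β≋ t≋)) γ≋

quad′-cong : ∀ {m} α {β β′ t t′} → β ≋ β′ [mod m ] → t ≋ t′ [mod m ] →
             quad′ α β t ≋ quad′ α β′ t′ [mod m ]
quad′-cong α β≋ t≋ = +-cong (*-congˡ (+ 2 * α) t≋) β≋

taylor : ∀ α β γ t h → quad α β γ (t - h) ≡ quad α β γ t - quad′ α β t * h + α * (h * h)
taylor = expanded
  where expanded : ∀ α β γ t h → α * (t - h) * (t - h) + β * (t - h) + γ ≡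
                                 (α * t * t + β * t + γ) - (+ 2 * α * t + β) * h + α * (h * h)
        expanded = solve-∀

-- A Newton step  t ↦ t - q(t)·e  changes the value of q to
-- q(t)·(1 - q′(t)·e) + α e² q(t)², the source of the gain in precision.
newton-step : ∀ α β γ t e →
  quad α β γ (t - quad α β γ t * e) ≡
  (1ℤ - quad′ α β t * e) * quad α β γ t + α * e * e * (quad α β γ t * quad α β γ t)
newton-step α β γ t e =
  trans (taylor α β γ t (quad α β γ t * e)) (regroup (quad α β γ t) (quad′ α β t) α e)
  where regroup : ∀ q q′ α e → q - q′ * (q * e) + α * (q * e * (q * e)) ≡ (1ℤ - q′ * e) * q + α * e * e * (q * q)
        regroup = solve-∀

module Hensel {p : ℕ} (α : ℤ) (β γ : Seq)
              (β-coh : ResidueSequences.IsCoherent p β) (γ-coh : ResidueSequences.IsCoherent p γ)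
              (t₀ e : ℤ) (root : quad α (β 1) (γ 1) t₀ ≋ 0ℤ [mod p ])
              (simple : quad′ α (β 1) t₀ * e ≋ 1ℤ [mod p ]) where
  open ResidueSequences p

  F : ℕ → ℤ → ℤ
  F k = quad α (β k) (γ k)

  approx : ℕ → ℤ
  approx ℕ.zero    = t₀
  approx (ℕ.suc k) = approx k - F (ℕ.suc k) (approx k) * e

  F-near-t₀ : ∀ k {t} → t ≋ t₀ [mod p ] → F (ℕ.suc k) t ≋ 0ℤ [mod p ]
  F-near-t₀ k t≋t₀ = ≋-trans (quad-cong α (coherent⇒level₁ β-coh k) (coherent⇒level₁ γ-coh k) t≋t₀) root

  F′-near-t₀ : ∀ k {t} → t ≋ t₀ [mod p ] → 1ℤ - quad′ α (β (ℕ.suc k)) t * e ≋ 0ℤ [mod p ]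
  F′-near-t₀ k {t} t≋t₀ = begin
    1ℤ - quad′ α (β (ℕ.suc k)) t * e  ≈⟨ -cong (≋-refl {x = 1ℤ})
                                                (*-congʳ e (quad′-cong α (coherent⇒level₁ β-coh k) t≋t₀)) ⟩
    1ℤ - quad′ α (β 1) t₀ * e         ≈⟨ -cong (≋-refl {x = 1ℤ}) simple ⟩
    1ℤ - 1ℤ                           ≡⟨⟩
    0ℤ                                ∎
    where open ≋-Reasoning p

  F-step : ∀ k t → F (ℕ.suc k) t ≋ F k t [mod p ℕ.^ k ]
  F-step k t = quad-cong α (β-coh k) (γ-coh k) (≋-refl {x = t})

  approx≋t₀ : ∀ k → approx k ≋ t₀ [mod p ]
  approx≋t₀ ℕ.zero    = ≋-refl
  approx≋t₀ (ℕ.suc k) = ≋-trans (-cong (approx≋t₀ k) (*-congʳ e (F-near-t₀ k (approx≋t₀ k))))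
                                (≡⇒≋ (ℤ.+-identityʳ t₀))

  approx-root : ∀ k → F k (approx k) ≋ 0ℤ [mod p ℕ.^ k ]

  correction≋0 : ∀ k → F (ℕ.suc k) (approx k) ≋ 0ℤ [mod p ℕ.^ k ]
  correction≋0 k = ≋-trans (F-step k (approx k)) (approx-root k)

  approx-root ℕ.zero    = ≋-mod-1
  approx-root (ℕ.suc k) = begin
    F (ℕ.suc k) (approx (ℕ.suc k))              ≡⟨ newton-step α (β (ℕ.suc k)) (γ (ℕ.suc k)) t e ⟩
    (1ℤ - quad′ α (β (ℕ.suc k)) t * e) * D + α * e * e * (D * D)
                                                ≈⟨ +-cong (*-zero (F′-near-t₀ k (approx≋t₀ k)) (correction≋0 k))
                                                          (*-zeroˡ (α * e * e) (*-zero (F-near-t₀ k (approx≋t₀ k)) (correction≋0 k))) ⟩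
    0ℤ                                          ∎
    where
    open ≋-Reasoning (p ℕ.^ ℕ.suc k)
    t D : ℤ
    t = approx k
    D = F (ℕ.suc k) t

  approx-coh : IsCoherent approx
  approx-coh k = ≋-trans (-cong (≋-refl {x = approx k}) (*-congʳ e (correction≋0 k)))
                         (≡⇒≋ (ℤ.+-identityʳ (approx k)))

  lift : Σ (ℤₚ p) λ t → ∀ k → F k (res t k) ≋ 0ℤ [mod p ℕ.^ k ]
  lift = fromCoherent approx approx-coh , approx-root

module Units {p : ℕ} (p-prime : Prime p) (odd : p % 2 ≡ 1) where
  open PrimeModulus p-prime
  open OddPrime p-prime odd
  open ResidueSequences p

  -- Units are invertible in ℤₚ: Hensel's lemma for the linear equation
  -- w t - 1 = 0, starting from an inverse e of w₁ modulo p.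
  inverseₚ : ∀ {w} → IsCoherent w → ¬ (+ p ∣ w 1) → Σ (ℤₚ p) λ f → w ⊗ res f ≃ cst 1ℤ
  inverseₚ {w} w-coh p∤w₁ = lift-inverse (inverse (w 1) p∤w₁)
    where
    linear : ∀ w t → quad 0ℤ w (- 1ℤ) t ≡ w * t - 1ℤ
    linear = expanded
      where expanded : ∀ w t → 0ℤ * t * t + w * t + - 1ℤ ≡ w * t - 1ℤ
            expanded = solve-∀
    linear′ : ∀ w t → quad′ 0ℤ w t * t ≡ w * t
    linear′ = expanded
      where expanded : ∀ w t → (+ 2 * 0ℤ * t + w) * t ≡ w * t
            expanded = solve-∀
    lift-inverse : (Σ ℤ λ e → w 1 * e ≋ 1ℤ [mod p ]) → Σ (ℤₚ p) λ f → w ⊗ res f ≃ cst 1ℤ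
    lift-inverse (e , w₁e≋1) = f , λ k → diff≋0⇒≋ (≋-trans (≡⇒≋ (sym (linear (w k) (res f k)))) (f-root k))
      where
      root : quad 0ℤ (w 1) (- 1ℤ) e ≋ 0ℤ [mod p ]
      root = ≋-trans (≡⇒≋ (linear (w 1) e)) (≋⇒diff≋0 w₁e≋1)
      open Hensel 0ℤ w (cst (- 1ℤ)) w-coh (cst-coh _) e e root (≋-trans (≡⇒≋ (linear′ (w 1) e)) w₁e≋1)
      f : ℤₚ p
      f = proj₁ lift
      f-root : ∀ k → quad 0ℤ (w k) (- 1ℤ) (res f k) ≋ 0ℤ [mod p ℕ.^ k ]
      f-root = proj₂ lift

  -- A unit v that is a square s₀² modulo p is a square in ℤₚ: Hensel's lemma
  -- for t² - v = 0, whose derivative 2 s₀ is a unit because p is odd.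
  sqrtₚ : ∀ {v} → IsCoherent v → ∀ s₀ → ¬ (+ p ∣ s₀) → s₀ * s₀ ≋ v 1 [mod p ] →
          Σ (ℤₚ p) λ s → res s ⊗ res s ≃ v
  sqrtₚ {v} v-coh s₀ p∤s₀ s₀²≋v₁ = lift-root (inverse (+ 2 * s₀) ([ p∤2 , p∤s₀ ] ∘ euclid (+ 2) s₀))
    where
    pure : ∀ t v → quad 1ℤ 0ℤ (0ℤ - v) t ≡ t * t - v
    pure = expanded
      where expanded : ∀ t v → 1ℤ * t * t + 0ℤ * t + (0ℤ - v) ≡ t * t - v
            expanded = solve-∀
    pure′ : ∀ t e → quad′ 1ℤ 0ℤ t * e ≡ + 2 * t * e
    pure′ = expanded
      where expanded : ∀ t e → (+ 2 * 1ℤ * t + 0ℤ) * e ≡ + 2 * t * e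
            expanded = solve-∀
    lift-root : (Σ ℤ λ e → + 2 * s₀ * e ≋ 1ℤ [mod p ]) → Σ (ℤₚ p) λ s → res s ⊗ res s ≃ v
    lift-root (e , 2s₀e≋1) = s , λ k → diff≋0⇒≋ (≋-trans (≡⇒≋ (sym (pure (res s k) (v k)))) (s-root k))
      where
      root : quad 1ℤ 0ℤ (0ℤ - v 1) s₀ ≋ 0ℤ [mod p ]
      root = ≋-trans (≡⇒≋ (pure s₀ (v 1))) (≋⇒diff≋0 s₀²≋v₁)
      open Hensel 1ℤ (cst 0ℤ) (cst 0ℤ ⊖ v) (cst-coh 0ℤ) (⊖-coh (cst-coh 0ℤ) v-coh) s₀ e root
                  (≋-trans (≡⇒≋ (pure′ s₀ e)) 2s₀e≋1)
      s : ℤₚ p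
      s = proj₁ lift
      s-root : ∀ k → quad 1ℤ 0ℤ (0ℤ - v k) (res s k) ≋ 0ℤ [mod p ℕ.^ k ]
      s-root = proj₂ lift

  -- Every unit of ℤₚ is a sum of two squares: write u₁ ≡ s₀² + t₀² (mod p)
  -- with p ∤ s₀ and lift s₀ to a square root of u - t₀².
  unit-sum-of-two-squares : ∀ {u} → IsCoherent u → ¬ (+ p ∣ u 1) → SumOfTwoSquares u
  unit-sum-of-two-squares {u} u-coh p∤u₁ = lift-sum (sum-of-two-squares-unit (u 1) p∤u₁)
    where
    lift-sum : (∃₂ λ s₀ t₀ → (s₀ * s₀ + t₀ * t₀ ≋ u 1 [mod p ]) × ¬ (+ p ∣ s₀)) → SumOfTwoSquares u
    lift-sum (s₀ , t₀ , s₀²+t₀²≋u₁ , p∤s₀) =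
      s , constₚ t₀ , λ k → ≋-sym (+-move (s²≃u-t₀² k))
      where
      root : Σ (ℤₚ p) λ s → res s ⊗ res s ≃ u ⊖ cst (t₀ * t₀)
      root = sqrtₚ (⊖-coh u-coh (cst-coh (t₀ * t₀))) s₀ p∤s₀ (-move s₀²+t₀²≋u₁)
      s : ℤₚ p
      s = proj₁ root
      s²≃u-t₀² : res s ⊗ res s ≃ u ⊖ cst (t₀ * t₀)
      s²≃u-t₀² = proj₂ root

  -- If u·w is a sum of two squares and w is a unit, so is u:
  -- u = (u w)·w⁻¹ and the unit w⁻¹ is a sum of two squares.
  divide-by-unit : ∀ {u w} → IsCoherent w → ¬ (+ p ∣ w 1) →
                   SumOfTwoSquares (u ⊗ w) → SumOfTwoSquares u
  divide-by-unit {u} {w} w-coh p∤w₁ uw-sum =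
    sum-of-two-squares-resp u≃uw·f (sum-of-two-squares-* uw-sum (unit-sum-of-two-squares (coherent f) p∤f₁))
    where
    f : ℤₚ p
    f = proj₁ (inverseₚ w-coh p∤w₁)
    wf≃1 : w ⊗ res f ≃ cst 1ℤ
    wf≃1 = proj₂ (inverseₚ w-coh p∤w₁)
    u≃uw·f : u ≃ (u ⊗ w) ⊗ res f
    u≃uw·f k = ≋-trans (≡⇒≋ (sym (ℤ.*-identityʳ (u k))))
                 (≋-trans (*-congˡ (u k) (≋-sym (wf≃1 k))) (≡⇒≋ (sym (ℤ.*-assoc (u k) (w k) (res f k)))))
    p∤f₁ : ¬ (+ p ∣ res f 1)
    p∤f₁ p∣f₁ = p∤1 (≋0⇒∣ (≋-trans (≋-sym (level₁⇒mod-p (wf≃1 1))) (*-zeroˡ (w 1) (∣⇒≋0 p∣f₁))))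

  factor-sum-of-two-squares : ∀ {u w} → IsCoherent u → IsCoherent w → ¬ ((+ p ∣ u 1) × (+ p ∣ w 1)) →
                              SumOfTwoSquares (u ⊗ w) → SumOfTwoSquares u
  factor-sum-of-two-squares {u} u-coh w-coh not-both uw-sum = by-cases (p ℕ.∣? ∣ u 1 ∣)
    where
    by-cases : Dec (+ p ∣ u 1) → SumOfTwoSquares u
    by-cases (no  p∤u₁) = unit-sum-of-two-squares u-coh p∤u₁
    by-cases (yes p∣u₁) = divide-by-unit w-coh (λ p∣w₁ → not-both (p∣u₁ , p∣w₁)) uw-sum

module GFactorisation (n : ℤ) (b : ℕ) (z : Seq) (k : ℕ) where

  gTerm : ℕ → ℕ → Seq
  gTerm a i = cst (n ^ (a ℕ.∸ 1 ℕ.∸ i)) ⊗ z ⊙^ (i ℕ.* b)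

  gTerm-shift : ∀ a m → m ℕ.≤ a → sumSeq m (gTerm (ℕ.suc a)) k ≡ n * sumSeq m (gTerm a) k
  gTerm-shift a ℕ.zero    _     = sym (ℤ.*-zeroʳ n)
  gTerm-shift a (ℕ.suc m) m<a = begin
    sumSeq m (gTerm (ℕ.suc a)) k + n ^ (a ℕ.∸ m) * z k ^ (m ℕ.* b)
      ≡⟨ cong₂ (λ s e → s + n ^ e * z k ^ (m ℕ.* b)) (gTerm-shift a m (ℕ.<⇒≤ m<a)) (exponent a m<a) ⟩
    n * sumSeq m (gTerm a) k + n * n ^ (a ℕ.∸ 1 ℕ.∸ m) * z k ^ (m ℕ.* b)
      ≡⟨ factor-n n (sumSeq m (gTerm a) k) (n ^ (a ℕ.∸ 1 ℕ.∸ m)) (z k ^ (m ℕ.* b)) ⟩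
    n * (sumSeq m (gTerm a) k + n ^ (a ℕ.∸ 1 ℕ.∸ m) * z k ^ (m ℕ.* b)) ∎
    where
    open ≡-Reasoning
    exponent : ∀ a {m} → m ℕ.< a → a ℕ.∸ m ≡ ℕ.suc (a ℕ.∸ 1 ℕ.∸ m)
    exponent (ℕ.suc a) (ℕ.s≤s m≤a) = ℕ.+-∸-assoc 1 m≤a
    factor-n : ∀ n s c x → n * s + n * c * x ≡ n * (s + c * x)
    factor-n = solve-∀

  g-step : ∀ a → gSeq n (ℕ.suc a) b z k ≡ n * gSeq n a b z k + z k ^ (a ℕ.* b)
  g-step a = cong₂ _+_ (gTerm-shift a a ℕ.≤-refl)
                       (trans (cong (λ e → n ^ e * z k ^ (a ℕ.* b)) (ℕ.n∸n≡0 a)) (ℤ.*-identityˡ _))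

  g-telescope : ∀ a → (n - z k ^ b) * gSeq n a b z k ≡ n ^ a - z k ^ (a ℕ.* b)
  g-telescope ℕ.zero    = ℤ.*-zeroʳ (n - z k ^ b)
  g-telescope (ℕ.suc a) = begin
    (n - Zᵇ) * gSeq n (ℕ.suc a) b z k            ≡⟨ cong ((n - Zᵇ) *_) (g-step a) ⟩
    (n - Zᵇ) * (n * gSeq n a b z k + Zᵃᵇ)        ≡⟨ expand n Zᵇ (gSeq n a b z k) Zᵃᵇ ⟩
    n * ((n - Zᵇ) * gSeq n a b z k) + (n - Zᵇ) * Zᵃᵇ ≡⟨ cong (λ t → n * t + (n - Zᵇ) * Zᵃᵇ) (g-telescope a) ⟩
    n * (n ^ a - Zᵃᵇ) + (n - Zᵇ) * Zᵃᵇ           ≡⟨ collect n Zᵇ (n ^ a) Zᵃᵇ ⟩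
    n * n ^ a - Zᵇ * Zᵃᵇ                         ≡⟨ cong (_-_ (n * n ^ a)) (sym (ℤ.^-distribˡ-+-* (z k) b (a ℕ.* b))) ⟩
    n ^ ℕ.suc a - z k ^ (ℕ.suc a ℕ.* b)          ∎
    where
    open ≡-Reasoning
    Zᵇ Zᵃᵇ : ℤ
    Zᵇ = z k ^ b
    Zᵃᵇ = z k ^ (a ℕ.* b)
    expand : ∀ n Zᵇ g Zᵃᵇ → (n - Zᵇ) * (n * g + Zᵃᵇ) ≡ n * ((n - Zᵇ) * g) + (n - Zᵇ) * Zᵃᵇ
    expand = solve-∀
    collect : ∀ n Zᵇ nᵃ Zᵃᵇ → n * (nᵃ - Zᵃᵇ) + (n - Zᵇ) * Zᵃᵇ ≡ n * nᵃ - Zᵇ * Zᵃᵇ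
    collect = solve-∀

  -- Modulo any m dividing n - Z^b, each summand of g is n^{a-1}, so
  -- n·g_a(Z) ≡ a·n^a (stated after multiplying by n to avoid a - 1).
  g-at-root : ∀ {m} a → z k ^ b ≋ n [mod m ] → n * gSeq n a b z k ≋ + a * n ^ a [mod m ]
  g-at-root ℕ.zero    _    = ≡⇒≋ (ℤ.*-zeroʳ n)
  g-at-root (ℕ.suc a) Zᵇ≋n = begin
    n * gSeq n (ℕ.suc a) b z k             ≡⟨ cong (n *_) (g-step a) ⟩
    n * (n * gSeq n a b z k + Zᵃᵇ)         ≡⟨ ℤ.*-distribˡ-+ n (n * gSeq n a b z k) Zᵃᵇ ⟩
    n * (n * gSeq n a b z k) + n * Zᵃᵇ     ≈⟨ +-cong (*-congˡ n (g-at-root a Zᵇ≋n)) (*-congˡ n Zᵃᵇ≋nᵃ) ⟩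
    n * (+ a * n ^ a) + n * n ^ a          ≡⟨ collect n (+ a) (n ^ a) ⟩
    (1ℤ + + a) * (n * n ^ a)               ∎
    where
    open ≋-Reasoning _
    Zᵃᵇ : ℤ
    Zᵃᵇ = z k ^ (a ℕ.* b)
    Zᵃᵇ≋nᵃ : Zᵃᵇ ≋ n ^ a [mod _ ]
    Zᵃᵇ≋nᵃ = ≋-trans (≡⇒≋ (trans (cong (z k ^_) (ℕ.*-comm a b)) (sym (ℤ.^-*-assoc (z k) b a)))) (^-cong a Zᵇ≋n)
    collect : ∀ n a nᵃ → n * (a * nᵃ) + n * nᵃ ≡ (1ℤ + a) * (n * nᵃ)
    collect = solve-∀

module Point {p : ℕ} (n : ℤ) (a b : ℕ) (x y z : ℤₚ p) (onX : OnX p n a b x y z) where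
  open ResidueSequences p
  open GFactorisation n b (res z)

  u w : Seq
  u = cst n ⊖ res z ⊙^ b
  w = gSeq n a b (res z)

  u-coh : IsCoherent u
  u-coh = ⊖-coh (cst-coh n) (⊙^-coh b (coherent z))

  w-coh : IsCoherent w
  w-coh = sumSeq-coh a (λ i → ⊗-coh (cst-coh (n ^ (a ℕ.∸ 1 ℕ.∸ i))) (⊙^-coh (i ℕ.* b) (coherent z)))

  uw-sum : SumOfTwoSquares (u ⊗ w)
  uw-sum = x , y , uw≃X²+Y²
    where
    X Y Zᵃᵇ : Seq
    X = res x
    Y = res y
    Zᵃᵇ k = res z k ^ (a ℕ.* b)
    cancel : ∀ s t → (s + t) - t ≡ s
    cancel = solve-∀
    uw≃X²+Y² : u ⊗ w ≃ X ⊗ X ⊕ Y ⊗ Y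
    uw≃X²+Y² k = begin
      u k * w k                               ≡⟨ g-telescope k a ⟩
      n ^ a - Zᵃᵇ k                           ≈⟨ -cong (≋-sym on-𝔛) (≋-refl {x = Zᵃᵇ k}) ⟩
      (X k ^ 2 + Y k ^ 2 + Zᵃᵇ k) - Zᵃᵇ k     ≡⟨ cong₂ (λ s t → (s + t + Zᵃᵇ k) - Zᵃᵇ k)
                                                         (^2≡* (X k)) (^2≡* (Y k)) ⟩
      (X k * X k + Y k * Y k + Zᵃᵇ k) - Zᵃᵇ k ≡⟨ cancel (X k * X k + Y k * Y k) (Zᵃᵇ k) ⟩
      X k * X k + Y k * Y k                   ∎
      where
      open ≋-Reasoning (p ℕ.^ k)
      on-𝔛 : X k ^ 2 + Y k ^ 2 + Zᵃᵇ k ≋ n ^ a [mod p ℕ.^ k ]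
      on-𝔛 = ≡mod⇒≋ (onX k)

  -- A prime p ∤ a n cannot divide both n - z₁^b and g(z₁): modulo such a
  -- p we would have  0 ≡ n g(z₁) ≡ a n^a.
  not-both : Prime p → ¬ (+ p ∣ + a * n) → ¬ ((+ p ∣ u 1) × (+ p ∣ w 1))
  not-both p-prime p∤an (p∣u₁ , p∣w₁) = [ p∤a , ∤-^ a p∤n ] (euclid (+ a) (n ^ a) p∣anᵃ)
    where
    open PrimeModulus p-prime
    zᵇ≋n : res z 1 ^ b ≋ n [mod p ]
    zᵇ≋n = ≋-sym (diff≋0⇒≋ (∣⇒≋0 {x = u 1} p∣u₁))
    p∣anᵃ : + p ∣ + a * n ^ a
    p∣anᵃ = ≋0⇒∣ (≋-trans (≋-sym (g-at-root 1 a zᵇ≋n)) (*-zeroˡ n (∣⇒≋0 p∣w₁)))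
    p∤a : ¬ (+ p ∣ + a)
    p∤a p∣a = p∤an (∣-*ʳ (+ a) n p∣a)
    p∤n : ¬ (+ p ∣ n)
    p∤n p∣n = p∤an (∣-*ˡ (+ a) n p∣n)

3mod4⇒odd : ∀ p → p % 4 ≡ 3 → p % 2 ≡ 1
3mod4⇒odd p p≡3 = trans (sym (ℕ.m∣n⇒o%n%m≡o%m 2 4 p (ℕ.divides 2 refl))) (cong (_% 2) p≡3)

-- At every ℤₚ-point both n - z^b and g(z) are sums of two squares in ℤₚ,
-- so the local invariant of A never equals 1/2.
lemma3p15 : (n : ℤ) (a b p : ℕ) → n ≢ + 0 → a % 2 ≡ 1 → b % 2 ≡ 1 →
    Prime p → p % 4 ≡ 3 → ¬ ((+ p) ∣ ((+ a) Data.Integer.* n)) →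
    ¬ HalfInIₚ p n a b
lemma3p15 n a b p _ _ _ p-prime p≡3 p∤an (x , y , z , onX , inv-half) =
  [ (λ (_ , not-sum) → not-sum (toSumTwoSqQₚ u-sum)) , (λ (_ , not-sum) → not-sum (toSumTwoSqQₚ w-sum)) ] inv-half
  where
  open ResidueSequences p
  open Units p-prime (3mod4⇒odd p p≡3)
  open Point n a b x y z onX
  u-sum : SumOfTwoSquares u
  u-sum = factor-sum-of-two-squares u-coh w-coh (not-both p-prime p∤an) uw-sum
  w-sum : SumOfTwoSquares w
  w-sum = factor-sum-of-two-squares w-coh u-coh (not-both p-prime p∤an ∘ swap)
            (sum-of-two-squares-resp (λ k → ≡⇒≋ (ℤ.*-comm (w k) (u k))) uw-sum)
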